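{- Let $a,b,c$ be integers with $a+1\geqslant b$, $a+1\geqslant c$, $b+1\geqslant c\geqslant 1$. Then \begin{multline*} H_{\mathrm{comb}}(a,b,c)=H_{\mathrm{comb}}(a+2,b+2,c-2)+(qt)^cH(a+c,b-c)+(qt)^{c-1}H(a+c,b-c+2)\\ +\sum_{2\leqslant\ell\leqslant\min(2c,a-b)}q^{a+2c-\ell}t^{\ell+b}-\delta_{a,b-1}q^{a+2c}t^{b}-(\delta_{a,b}+\delta_{a,b-1})q^{a+2c-1}t^{b+1}. \end{multline*}
   Context: For integers $a,b,c$ let $A=a+2b+3c$, $\epsilon_{ij}=\max(0,i+j-b-c)$, $m_{cj}\in\{0,1\}$ with $m_{cj}\equiv c-j\pmod 2$, \[\widetilde{Q}(a,b,c)=\{(i,j)\in\mathbb{Z}^2\mid 0\leqslant j\leqslant c,\ j\leqslant i\leqslant b+c,\ 2i+2j\leqslant a+b+2c-m_{cj}\},\] and $H_{\mathrm{comb}}(a,b,c)=\sum_{(i,j)\in\widetilde{Q}(a,b,c)}q^{A-2i-j}t^{i+\epsilon_{ij}}$ (with $\epsilon_{ij}$, $m_{cj}$, $A$ computed from the given $a,b,c$). For integers $a$ and $b\geqslant -1$, $H(a,b)=q^{a}\sum_{i=0}^{b}(q^2)^{b-i}t^{i}$ (so $H(a,-1)=0$). $\delta_{x,y}$ is the Kronecker delta; empty sums are $0$. -}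

module Defs where

open import Data.Nat as ℕ using (ℕ)
open import Data.Nat.DivMod as ND using ()
open import Data.Integer
open import Data.Bool using (Bool; true; false; if_then_else_; _∧_)
open import Data.List using (List; []; _∷_; map; concatMap; upTo; _++_; foldr)
open import Data.Product using (_×_; _,_)
open import Relation.Nullary using (does)
open import Relation.Binary.PropositionalEquality using (_≡_)

2ℤ 3ℤ : ℤ
2ℤ = + 2
3ℤ = + 3

-- Laurent polynomials in q, t with integer coefficients, represented as
-- finite lists of monomials (coefficient , exponent of q , exponent of t).
Mono : Set
Mono = ℤ × ℤ × ℤ

Poly : Set
Poly = List Mono

coeff : Poly → ℤ → ℤ → ℤ
coeff [] m n = 0ℤ
coeff ((k , e , f) ∷ p) m n =
  (if does (e ≟ m) ∧ does (f ≟ n) then k else 0ℤ) + coeff p m n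

infix 4 _≈P_
_≈P_ : Poly → Poly → Set
P ≈P Q = ∀ m n → coeff P m n ≡ coeff Q m n

shift : ℤ → ℤ → Poly → Poly
shift e f = map (λ { (k , x , y) → (k , x + e , y + f) })

negP : Poly → Poly
negP = map (λ { (k , x , y) → (- k , x , y) })

-- integers lo, lo+1, ..., hi (empty if hi < lo)
len : ℤ → ℕ
len (+ n) = n
len -[1+ n ] = 0

range : ℤ → ℤ → List ℤ
range lo hi = map (λ k → lo + + k) (upTo (len (hi - lo + 1ℤ)))

δ : ℤ → ℤ → ℤ
δ x y = if does (x ≟ y) then 1ℤ else 0ℤ

mpar : ℤ → ℤ → ℤ
mpar c j = + (∣ c - j ∣ ND.% 2)

eps : ℤ → ℤ → ℤ → ℤ → ℤ
eps b c i j = 0ℤ ⊔ (i + j - b - c)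

Hcomb : ℤ → ℤ → ℤ → Poly
Hcomb a b c =
  concatMap (λ j →
    concatMap (λ i →
      if does (2ℤ * i + 2ℤ * j ≤? a + b + 2ℤ * c - mpar c j)
      then (1ℤ , (a + 2ℤ * b + 3ℤ * c) - 2ℤ * i - j , i + eps b c i j) ∷ []
      else [])
      (range j (b + c)))
    (range 0ℤ c)

H : ℤ → ℤ → Poly
H a b = map (λ i → (1ℤ , a + 2ℤ * (b - i) , i)) (range 0ℤ b)

Ssum : ℤ → ℤ → ℤ → Poly
Ssum a b c = map (λ l → (1ℤ , a + 2ℤ * c - l , l + b)) (range 2ℤ ((2ℤ * c) ⊓ (a - b)))

RHS : ℤ → ℤ → ℤ → Poly
RHS a b c =
  Hcomb (a + 2ℤ) (b + 2ℤ) (c - 2ℤ)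
  ++ shift c c (H (a + c) (b - c))
  ++ shift (c - 1ℤ) (c - 1ℤ) (H (a + c) (b - c + 2ℤ))
  ++ Ssum a b c
  ++ ((- δ a (b - 1ℤ)) , a + 2ℤ * c , b) ∷ []
  ++ ((- (δ a b + δ a (b - 1ℤ))) , a + 2ℤ * c - 1ℤ , b + 1ℤ) ∷ []

-- Split H_comb(a,b,c) into its rows j = 0, …, c.  The substitution (a,b,c) ↦ (a+2,b+2,c-2)
-- preserves A, b + c, ε_ij and the parity m_cj, so the rows j ≤ c-2 are exactly those of
-- H_comb(a+2,b+2,c-2).  Call the row j = c the top row and j = c-1 the next row.  Their terms with
-- i ≤ b (top) resp. i ≤ b+1 (next) have ε_ij = 0 and are the terms of (qt)^c H(a+c,b-c) resp.
-- (qt)^(c-1) H(a+c,b-c+2), except that, as a ≥ b-1, the constraint of Q̃ removes the last of them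
-- exactly when a < b resp. a < b+1; the δ-terms subtract it in that case.  Writing i = b+k
-- resp. i = b+1+k, the remaining terms are q^(a+2c-ℓ) t^(ℓ+b) with ℓ = 2k resp. ℓ = 2k+1,
-- present iff ℓ ≤ a-b, and even and odd ℓ together form the sum over 2 ≤ ℓ ≤ min(2c, a-b).
module Submission where

open import Defs
open import Data.Integer using (ℤ; _+_; _≤_; 1ℤ)

open import Data.Bool using (Bool; true; false; if_then_else_; _∧_)
open import Data.Integer as ℤ
  using (+_; -[1+_]; +[1+_]; _-_; _*_; -_; _<_; _≤?_; _⊓_; _⊔_; 0ℤ; 2ℤ; +≤+; +<+; ∣_∣)
import Data.Integer.Properties as ℤ
open import Algebra.Properties.CommutativeSemigroup ℤ.+-commutativeSemigroup using (xy∙z≈xz∙y)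
open import Data.Integer.Tactic.RingSolver using (solve; solve-∀)
open import Data.List using (List; []; _∷_; _++_; map; concat; concatMap; applyUpTo; upTo; filter)
import Data.List.Properties as List
open import Data.List.Relation.Unary.All using (All)
import Data.List.Relation.Unary.All.Properties as All
open import Data.Nat as ℕ using (ℕ; zero; suc)
import Data.Nat.Properties as ℕ
open import Data.Nat.DivMod using (_%_; %-congˡ; [m+n]%n≡m%n)
open import Data.Product using (_,_)
open import Data.Sum using (_⊎_; inj₁; inj₂)
open import Function using (_∘_)
open import Function.Bundles using (mk⇔)
open import Relation.Binary.PropositionalEquality
open import Relation.Nullary using (¬_; Dec; yes; no; does)
open import Relation.Nullary.Decidable using (does-⇔; dec-true; dec-false)
open import Relation.Unary using (Decidable)
open ≡-Reasoning

private
  variable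
    lo mid hi z : ℤ

≤-by-difference : ∀ {p q p′ q′} → p′ ≤ q′ → q′ - p′ ≡ q - p → p ≤ q
≤-by-difference p′≤q′ eq = ℤ.0≤i-j⇒j≤i (subst (0ℤ ≤_) eq (ℤ.i≤j⇒0≤j-i p′≤q′))

-- Stated with 1ℤ + i rather than ℤ.suc i, which the ring solver cannot see through.
<⇒1+≤ : ∀ {i j} → i < j → 1ℤ + i ≤ j
<⇒1+≤ = ℤ.i<j⇒suc[i]≤j

+1≤⇒< : ∀ {i j} → i + 1ℤ ≤ j → i < j
+1≤⇒< {i} {j} i+1≤j = ℤ.suc[i]≤j⇒i<j (subst (_≤ j) (ℤ.+-comm i 1ℤ) i+1≤j)

i<i+1 : ∀ i → i < i + 1ℤ
i<i+1 i = +1≤⇒< ℤ.≤-refl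

i-1<i : ∀ i → i - 1ℤ < i
i-1<i i = +1≤⇒< (≤-by-difference (ℤ.≤-refl {i}) (solve (i ∷ [])))

≤+1-trichotomy : ∀ {a b} → b ≤ a + 1ℤ → a ≡ b - 1ℤ ⊎ a ≡ b ⊎ b < a
≤+1-trichotomy {a} {b} b≤a+1 with a ℤ.≟ b - 1ℤ
... | yes a≡b-1 = inj₁ a≡b-1
... | no a≢b-1 with a ℤ.≟ b
...   | yes a≡b = inj₂ (inj₁ a≡b)
...   | no a≢b = inj₂ (inj₂ (ℤ.≤∧≢⇒< b≤a (a≢b ∘ sym)))
  where
  b-1<a : b - 1ℤ < a
  b-1<a = ℤ.≤∧≢⇒< (≤-by-difference b≤a+1 (solve (a ∷ b ∷ []))) (a≢b-1 ∘ sym)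
  b≤a : b ≤ a
  b≤a = ≤-by-difference (<⇒1+≤ b-1<a) (solve (a ∷ b ∷ []))

does-≤?-by-difference : ∀ {p q p′ q′} → q′ - p′ ≡ q - p → does (p ≤? q) ≡ does (p′ ≤? q′)
does-≤?-by-difference {p} {q} {p′} {q′} eq =
  does-⇔ (mk⇔ (λ h → ≤-by-difference h (sym eq)) (λ h → ≤-by-difference h eq)) (p ≤? q) (p′ ≤? q′)

∣i-2∣%2≡∣i∣%2 : ∀ i → ∣ i - 2ℤ ∣ % 2 ≡ ∣ i ∣ % 2
∣i-2∣%2≡∣i∣%2 (+ 0) = refl
∣i-2∣%2≡∣i∣%2 (+ 1) = refl
∣i-2∣%2≡∣i∣%2 (+ suc (suc n)) = sym (trans (%-congˡ {o = 2} (ℕ.+-comm 2 n)) ([m+n]%n≡m%n n 2))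
∣i-2∣%2≡∣i∣%2 -[1+ n ] = trans (%-congˡ {o = 2} (cong suc (sym (ℕ.+-suc n 1)))) ([m+n]%n≡m%n (suc n) 2)

len-nonpositive : z ≤ 0ℤ → len z ≡ 0
len-nonpositive {+ zero} _ = refl
len-nonpositive {+[1+ _ ]} (+≤+ ())
len-nonpositive { -[1+ _ ]} _ = refl

+len : 0ℤ ≤ z → + len z ≡ z
+len {+ _} _ = refl

<len⇒< : ∀ {k} → k ℕ.< len z → + k < z
<len⇒< {+ _} k<n = +<+ k<n

applyUpTo-+ : ∀ {A : Set} (f : ℕ → A) m n →
  applyUpTo f (m ℕ.+ n) ≡ applyUpTo f m ++ applyUpTo (f ∘ (m ℕ.+_)) n
applyUpTo-+ f zero n = refl
applyUpTo-+ f (suc m) n = cong (f 0 ∷_) (applyUpTo-+ (f ∘ suc) m n)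

applyUpTo-cong : ∀ {A : Set} {f g : ℕ → A} → (∀ k → f k ≡ g k) → ∀ n → applyUpTo f n ≡ applyUpTo g n
applyUpTo-cong f≗g zero = refl
applyUpTo-cong f≗g (suc n) = cong₂ _∷_ (f≗g 0) (applyUpTo-cong (f≗g ∘ suc) n)

range-applyUpTo : ∀ lo hi → range lo hi ≡ applyUpTo (λ k → lo + + k) (len (hi - lo + 1ℤ))
range-applyUpTo lo hi = List.map-upTo (λ k → lo + + k) _

range-++ : lo ≤ mid + 1ℤ → mid ≤ hi → range lo hi ≡ range lo mid ++ range (mid + 1ℤ) hi
range-++ {lo} {mid} {hi} lo≤mid+1 mid≤hi = begin
  range lo hi                                            ≡⟨ range-applyUpTo lo hi ⟩
  applyUpTo f (len (hi - lo + 1ℤ))                       ≡⟨ cong (applyUpTo f) length-sum ⟩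
  applyUpTo f (m ℕ.+ n)                                  ≡⟨ applyUpTo-+ f m n ⟩
  applyUpTo f m ++ applyUpTo (f ∘ (m ℕ.+_)) n            ≡⟨ cong (applyUpTo f m ++_) (applyUpTo-cong restart n) ⟩
  applyUpTo f m ++ applyUpTo (λ k → (mid + 1ℤ) + + k) n  ≡⟨ sym (cong₂ _++_ (range-applyUpTo lo mid)
                                                                         (range-applyUpTo (mid + 1ℤ) hi)) ⟩
  range lo mid ++ range (mid + 1ℤ) hi                    ∎
  where
  f : ℕ → ℤ
  f k = lo + + k
  m n : ℕ
  m = len (mid - lo + 1ℤ)
  n = len (hi - (mid + 1ℤ) + 1ℤ)
  +m : + m ≡ mid - lo + 1ℤ
  +m = +len (≤-by-difference lo≤mid+1 (solve (lo ∷ mid ∷ [])))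
  +n : + n ≡ hi - (mid + 1ℤ) + 1ℤ
  +n = +len (≤-by-difference mid≤hi (solve (mid ∷ hi ∷ [])))
  length-sum : len (hi - lo + 1ℤ) ≡ m ℕ.+ n
  length-sum = ℤ.+-injective (begin
    + len (hi - lo + 1ℤ)                      ≡⟨ +len (≤-by-difference (ℤ.+-mono-≤ lo≤mid+1 mid≤hi)
                                                                       (solve (lo ∷ mid ∷ hi ∷ []))) ⟩
    hi - lo + 1ℤ                              ≡⟨ solve (lo ∷ mid ∷ hi ∷ []) ⟩
    (mid - lo + 1ℤ) + (hi - (mid + 1ℤ) + 1ℤ)  ≡⟨ sym (cong₂ _+_ +m +n) ⟩
    + m + + n                                 ≡⟨ sym (ℤ.pos-+ m n) ⟩
    + (m ℕ.+ n)                               ∎)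
  restart : ∀ k → lo + + (m ℕ.+ k) ≡ (mid + 1ℤ) + + k
  restart k = begin
    lo + + (m ℕ.+ k)              ≡⟨ cong (λ w → lo + w) (trans (ℤ.pos-+ m k) (cong (_+ + k) +m)) ⟩
    lo + ((mid - lo + 1ℤ) + + k)  ≡⟨ solve (lo ∷ mid ∷ []) ⟩
    (mid + 1ℤ) + + k              ∎

range-shift : ∀ lo hi s → range (lo + s) (hi + s) ≡ map (_+ s) (range lo hi)
range-shift lo hi s = begin
  map (λ k → (lo + s) + + k) (upTo (len ((hi + s) - (lo + s) + 1ℤ)))
    ≡⟨ cong (λ n → map (λ k → (lo + s) + + k) (upTo (len n))) same-length ⟩
  map (λ k → (lo + s) + + k) (upTo (len (hi - lo + 1ℤ)))
    ≡⟨ List.map-cong (λ k → xy∙z≈xz∙y lo s (+ k)) _ ⟩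
  map (λ k → (lo + + k) + s) (upTo (len (hi - lo + 1ℤ)))
    ≡⟨ List.map-∘ _ ⟩
  map (_+ s) (range lo hi) ∎
  where
  same-length : (hi + s) - (lo + s) + 1ℤ ≡ hi - lo + 1ℤ
  same-length = solve (lo ∷ hi ∷ s ∷ [])

range-singleton : ∀ z → range z z ≡ z ∷ []
range-singleton z = begin
  map (λ k → z + + k) (upTo (len (z - z + 1ℤ)))  ≡⟨ cong (λ n → map (λ k → z + + k) (upTo (len n))) one ⟩
  (z + 0ℤ) ∷ []                                  ≡⟨ cong (_∷ []) (ℤ.+-identityʳ z) ⟩
  z ∷ []                                         ∎
  where
  one : z - z + 1ℤ ≡ 1ℤ
  one = solve (z ∷ [])

range-empty : hi < lo → range lo hi ≡ []
range-empty {hi} {lo} hi<lo = cong (λ n → map (λ k → lo + + k) (upTo n))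
  (len-nonpositive {hi - lo + 1ℤ} (≤-by-difference (<⇒1+≤ hi<lo) (solve (hi ∷ lo ∷ []))))

range-∷ʳ : lo ≤ hi + 1ℤ → range lo (hi + 1ℤ) ≡ range lo hi ++ (hi + 1ℤ) ∷ []
range-∷ʳ {lo} {hi} lo≤hi+1 = begin
  range lo (hi + 1ℤ)                        ≡⟨ range-++ lo≤hi+1 (ℤ.<⇒≤ (i<i+1 hi)) ⟩
  range lo hi ++ range (hi + 1ℤ) (hi + 1ℤ)  ≡⟨ cong (range lo hi ++_) (range-singleton (hi + 1ℤ)) ⟩
  range lo hi ++ (hi + 1ℤ) ∷ []             ∎

range-init : lo ≤ hi → range lo hi ≡ range lo (hi - 1ℤ) ++ hi ∷ []
range-init {lo} {hi} lo≤hi = begin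
  range lo hi                                ≡⟨ cong (range lo) hi-1+1 ⟩
  range lo (hi - 1ℤ + 1ℤ)                    ≡⟨ range-∷ʳ {hi = hi - 1ℤ} (≤-by-difference lo≤hi
                                                                           (solve (lo ∷ hi ∷ []))) ⟩
  range lo (hi - 1ℤ) ++ (hi - 1ℤ + 1ℤ) ∷ []  ≡⟨ cong (λ z → range lo (hi - 1ℤ) ++ z ∷ []) (sym hi-1+1) ⟩
  range lo (hi - 1ℤ) ++ hi ∷ []              ∎
  where
  hi-1+1 : hi ≡ hi - 1ℤ + 1ℤ
  hi-1+1 = solve (hi ∷ [])

range-pair : ∀ z → range z (z + 1ℤ) ≡ z ∷ z + 1ℤ ∷ []
range-pair z = trans (range-∷ʳ {hi = z} (ℤ.<⇒≤ (i<i+1 z))) (cong (_++ (z + 1ℤ) ∷ []) (range-singleton z))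

All-range : ∀ {P : ℤ → Set} lo hi → (∀ {i} → lo ≤ i → i ≤ hi → P i) → All P (range lo hi)
All-range {P} lo hi bounded = subst (All P) (sym (range-applyUpTo lo hi))
  (All.applyUpTo⁺₁ _ _ λ {k} k<n → bounded (ℤ.i≤i+j lo (+ k)) (upper (<len⇒< k<n)))
  where
  upper : ∀ {K} → K < hi - lo + 1ℤ → lo + K ≤ hi
  upper {K} K<n = ≤-by-difference (<⇒1+≤ K<n) (solve (hi ∷ lo ∷ K ∷ []))

concatMap-cong-range : ∀ {A : Set} {t u : ℤ → List A} lo hi →
  (∀ {i} → lo ≤ i → i ≤ hi → t i ≡ u i) → concatMap t (range lo hi) ≡ concatMap u (range lo hi)
concatMap-cong-range lo hi t≡u = cong concat (List.map-cong-local (All-range lo hi t≡u))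

filter-≤-range : ∀ lo hi d → filter (_≤? d) (range lo hi) ≡ range lo (hi ⊓ d)
filter-≤-range lo hi d with hi ≤? d
... | yes hi≤d = begin
  filter (_≤? d) (range lo hi)  ≡⟨ List.filter-all (_≤? d) (All-range lo hi λ _ i≤hi → ℤ.≤-trans i≤hi hi≤d) ⟩
  range lo hi                   ≡⟨ cong (range lo) (sym (ℤ.i≤j⇒i⊓j≡i hi≤d)) ⟩
  range lo (hi ⊓ d)             ∎
... | no hi≰d with lo ≤? d + 1ℤ
...   | yes lo≤d+1 = begin
  filter (_≤? d) (range lo hi)
    ≡⟨ cong (filter (_≤? d)) (range-++ lo≤d+1 (ℤ.<⇒≤ d<hi)) ⟩
  filter (_≤? d) (range lo d ++ range (d + 1ℤ) hi)
    ≡⟨ List.filter-++ (_≤? d) (range lo d) _ ⟩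
  filter (_≤? d) (range lo d) ++ filter (_≤? d) (range (d + 1ℤ) hi)
    ≡⟨ cong₂ _++_ (List.filter-all (_≤? d) (All-range lo d λ _ i≤d → i≤d))
                  (List.filter-none (_≤? d) (All-range (d + 1ℤ) hi λ d+1≤i _ → ℤ.<⇒≱ (+1≤⇒< d+1≤i))) ⟩
  range lo d ++ []
    ≡⟨ List.++-identityʳ _ ⟩
  range lo d
    ≡⟨ cong (range lo) (sym (ℤ.i≥j⇒i⊓j≡j (ℤ.<⇒≤ d<hi))) ⟩
  range lo (hi ⊓ d) ∎
  where
  d<hi : d < hi
  d<hi = ℤ.≰⇒> hi≰d
...   | no lo≰d+1 = begin
  filter (_≤? d) (range lo hi)  ≡⟨ List.filter-none (_≤? d) (All-range lo hi λ lo≤i _ → below lo≤i) ⟩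
  []                            ≡⟨ sym (range-empty (ℤ.<-trans (i<i+1 d) (ℤ.≰⇒> lo≰d+1))) ⟩
  range lo d                    ≡⟨ cong (range lo) (sym (ℤ.i≥j⇒i⊓j≡j (ℤ.<⇒≤ (ℤ.≰⇒> hi≰d)))) ⟩
  range lo (hi ⊓ d)             ∎
  where
  below : ∀ {i} → lo ≤ i → ¬ i ≤ d
  below lo≤i i≤d = lo≰d+1 (ℤ.≤-trans lo≤i (ℤ.≤-trans i≤d (ℤ.<⇒≤ (i<i+1 d))))

-- Polynomials compared coefficientwise

coeff-++ : ∀ P Q m n → coeff (P ++ Q) m n ≡ coeff P m n + coeff Q m n
coeff-++ [] Q m n = sym (ℤ.+-identityˡ _)
coeff-++ ((k , e , f) ∷ P) Q m n = begin
  c₀ + coeff (P ++ Q) m n           ≡⟨ cong (λ z → c₀ + z) (coeff-++ P Q m n) ⟩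
  c₀ + (coeff P m n + coeff Q m n)  ≡⟨ sym (ℤ.+-assoc c₀ _ _) ⟩
  c₀ + coeff P m n + coeff Q m n    ∎
  where
  c₀ : ℤ
  c₀ = if does (e ℤ.≟ m) ∧ does (f ℤ.≟ n) then k else 0ℤ

≡⇒≈P : ∀ {P Q} → P ≡ Q → P ≈P Q
≡⇒≈P refl m n = refl

-- _≈P_ unfolds to a Π-type, so Agda cannot infer polynomials from it; they are passed explicitly.
++-cong : ∀ {P P′ Q Q′} → P ≈P P′ → Q ≈P Q′ → P ++ Q ≈P P′ ++ Q′
++-cong {P} {P′} {Q} {Q′} P≈P′ Q≈Q′ m n =
  trans (coeff-++ P Q m n) (trans (cong₂ _+_ (P≈P′ m n) (Q≈Q′ m n)) (sym (coeff-++ P′ Q′ m n)))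

coeff-concatMap-range-∷ʳ : ∀ (g : ℤ → Poly) lo hi → lo ≤ hi + 1ℤ → ∀ m n →
  coeff (concatMap g (range lo (hi + 1ℤ))) m n ≡ coeff (concatMap g (range lo hi)) m n + coeff (g (hi + 1ℤ)) m n
coeff-concatMap-range-∷ʳ g lo hi lo≤hi+1 m n = begin
  ⟦ concatMap g (range lo (hi + 1ℤ)) ⟧                  ≡⟨ cong (λ xs → ⟦ concatMap g xs ⟧) (range-∷ʳ {hi = hi} lo≤hi+1) ⟩
  ⟦ concatMap g (range lo hi ++ (hi + 1ℤ) ∷ []) ⟧       ≡⟨ cong ⟦_⟧ (List.concatMap-++ g (range lo hi) _) ⟩
  ⟦ concatMap g (range lo hi) ++ g (hi + 1ℤ) ++ [] ⟧    ≡⟨ coeff-++ (concatMap g (range lo hi)) _ m n ⟩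
  ⟦ concatMap g (range lo hi) ⟧ + ⟦ g (hi + 1ℤ) ++ [] ⟧ ≡⟨ cong (λ P → ⟦ concatMap g (range lo hi) ⟧ + ⟦ P ⟧)
                                                              (List.++-identityʳ (g (hi + 1ℤ))) ⟩
  ⟦ concatMap g (range lo hi) ⟧ + ⟦ g (hi + 1ℤ) ⟧       ∎
  where
  ⟦_⟧ : Poly → ℤ
  ⟦ P ⟧ = coeff P m n

guarded : Bool → Mono → Poly
guarded g x = if g then x ∷ [] else []

χ : Bool → ℤ
χ g = if g then 1ℤ else 0ℤ

χ-yes : ∀ {P : Set} (P? : Dec P) → P → χ (does P?) ≡ 1ℤ
χ-yes P? p = cong χ (dec-true P? p)

χ-no : ∀ {P : Set} (P? : Dec P) → ¬ P → χ (does P?) ≡ 0ℤ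
χ-no P? ¬p = cong χ (dec-false P? ¬p)

concatMap-guarded : ∀ {A : Set} {P : A → Set} (P? : Decidable P) (f : A → Mono) xs →
  concatMap (λ x → guarded (does (P? x)) (f x)) xs ≡ map f (filter P? xs)
concatMap-guarded P? f [] = refl
concatMap-guarded P? f (x ∷ xs) with does (P? x)
... | true = cong (f x ∷_) (concatMap-guarded P? f xs)
... | false = concatMap-guarded P? f xs

concatMap-singleton : ∀ {A B : Set} (f : A → B) xs → concatMap (λ x → f x ∷ []) xs ≡ map f xs
concatMap-singleton f xs = trans (sym (List.concatMap-map (_∷ []) f xs)) (List.concatMap-pure (map f xs))

zero-monomial : ∀ e x → (0ℤ , e , x) ∷ [] ≈P []
zero-monomial e x m n with does (e ℤ.≟ m) ∧ does (x ℤ.≟ n)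
... | true = refl
... | false = refl

guarded-split : ∀ {g k e x} → k ≡ χ g - 1ℤ → guarded g (1ℤ , e , x) ≈P (1ℤ , e , x) ∷ (k , e , x) ∷ []
guarded-split {true} {e = e} {x} refl m n with does (e ℤ.≟ m) ∧ does (x ℤ.≟ n)
... | true = refl
... | false = refl
guarded-split {false} {e = e} {x} refl m n with does (e ℤ.≟ m) ∧ does (x ℤ.≟ n)
... | true = refl
... | false = refl

concatMap-range-guarded-last : ∀ {t : ℤ → Poly} {f : ℤ → Mono} {g k e x} → lo ≤ hi →
  (∀ {i} → lo ≤ i → i < hi → t i ≡ f i ∷ []) →
  t hi ≡ guarded g (1ℤ , e , x) → f hi ≡ (1ℤ , e , x) → k ≡ χ g - 1ℤ →
  concatMap t (range lo hi) ≈P map f (range lo hi) ++ (k , e , x) ∷ []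
concatMap-range-guarded-last {lo} {hi} {t} {f} {g} {k} {e} {x} lo≤hi below top f-top k≡ =
  subst₂ _≈P_ (sym split) (sym full)
    (++-cong {map f init} {map f init} {guarded g (1ℤ , e , x)}
             (≡⇒≈P {map f init} refl) (guarded-split {g} {k} {e} {x} k≡))
  where
  init : List ℤ
  init = range lo (hi - 1ℤ)
  ≤-1⇒< : ∀ {i} → i ≤ hi - 1ℤ → i < hi
  ≤-1⇒< {i} i≤hi-1 = +1≤⇒< (≤-by-difference i≤hi-1 (solve (i ∷ hi ∷ [])))
  split : concatMap t (range lo hi) ≡ map f init ++ guarded g (1ℤ , e , x)
  split = begin
    concatMap t (range lo hi)       ≡⟨ cong (concatMap t) (range-init lo≤hi) ⟩
    concatMap t (init ++ hi ∷ [])   ≡⟨ List.concatMap-++ t init (hi ∷ []) ⟩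
    concatMap t init ++ t hi ++ []  ≡⟨ cong₂ _++_ (trans (concatMap-cong-range lo (hi - 1ℤ) λ lo≤i i≤hi-1 →
                                                            below lo≤i (≤-1⇒< i≤hi-1))
                                                          (concatMap-singleton f init))
                                                   (trans (List.++-identityʳ (t hi)) top) ⟩
    map f init ++ guarded g (1ℤ , e , x) ∎
  full : map f (range lo hi) ++ (k , e , x) ∷ [] ≡ map f init ++ (1ℤ , e , x) ∷ (k , e , x) ∷ []
  full = begin
    map f (range lo hi) ++ (k , e , x) ∷ []            ≡⟨ cong (λ xs → map f xs ++ (k , e , x) ∷ []) (range-init lo≤hi) ⟩
    map f (init ++ hi ∷ []) ++ (k , e , x) ∷ []        ≡⟨ cong (_++ (k , e , x) ∷ []) (List.map-++ f init (hi ∷ [])) ⟩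
    (map f init ++ f hi ∷ []) ++ (k , e , x) ∷ []      ≡⟨ List.++-assoc (map f init) _ _ ⟩
    map f init ++ f hi ∷ (k , e , x) ∷ []              ≡⟨ cong (λ y → map f init ++ y ∷ (k , e , x) ∷ []) f-top ⟩
    map f init ++ (1ℤ , e , x) ∷ (k , e , x) ∷ []      ∎

module _ (g : ℤ → Poly) where

  evens : ℤ → Poly
  evens N = concatMap (λ k → g (2ℤ * k)) (range 1ℤ N)

  odds : ℤ → Poly
  odds N = concatMap (λ k → g (2ℤ * k + 1ℤ)) (range 1ℤ (N - 1ℤ))

  evens-odds-step : ∀ {N} → 1ℤ ≤ N →
    concatMap g (range 2ℤ (2ℤ * N)) ≈P evens N ++ odds N →
    concatMap g (range 2ℤ (2ℤ * (N + 1ℤ))) ≈P evens (N + 1ℤ) ++ odds (N + 1ℤ)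
  evens-odds-step {N} 1≤N ih m n = begin
    ⟦ concatMap g (range 2ℤ (2ℤ * (N + 1ℤ))) ⟧
      ≡⟨ cong (λ z → ⟦ concatMap g (range 2ℤ z) ⟧) (sym even-top) ⟩
    ⟦ concatMap g (range 2ℤ (2ℤ * N + 1ℤ + 1ℤ)) ⟧
      ≡⟨ coeff-concatMap-range-∷ʳ g 2ℤ (2ℤ * N + 1ℤ) 2≤2N+2 m n ⟩
    ⟦ concatMap g (range 2ℤ (2ℤ * N + 1ℤ)) ⟧ + ⟦ g (2ℤ * N + 1ℤ + 1ℤ) ⟧
      ≡⟨ cong (_+ ⟦ g (2ℤ * N + 1ℤ + 1ℤ) ⟧) (coeff-concatMap-range-∷ʳ g 2ℤ (2ℤ * N) 2≤2N+1 m n) ⟩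
    ⟦ concatMap g (range 2ℤ (2ℤ * N)) ⟧ + ⟦ g (2ℤ * N + 1ℤ) ⟧ + ⟦ g (2ℤ * N + 1ℤ + 1ℤ) ⟧
      ≡⟨ cong (λ z → z + ⟦ g (2ℤ * N + 1ℤ) ⟧ + ⟦ g (2ℤ * N + 1ℤ + 1ℤ) ⟧)
              (trans (ih m n) (coeff-++ (evens N) _ m n)) ⟩
    ⟦ evens N ⟧ + ⟦ odds N ⟧ + ⟦ g (2ℤ * N + 1ℤ) ⟧ + ⟦ g (2ℤ * N + 1ℤ + 1ℤ) ⟧
      ≡⟨ regroup ⟦ evens N ⟧ ⟦ odds N ⟧ _ _ ⟩
    (⟦ evens N ⟧ + ⟦ g (2ℤ * N + 1ℤ + 1ℤ) ⟧) + (⟦ odds N ⟧ + ⟦ g (2ℤ * N + 1ℤ) ⟧)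
      ≡⟨ cong₂ (λ e o → (⟦ evens N ⟧ + ⟦ g e ⟧) + (⟦ odds N ⟧ + ⟦ g o ⟧)) even-top odd-top ⟩
    (⟦ evens N ⟧ + ⟦ g (2ℤ * (N + 1ℤ)) ⟧) + (⟦ odds N ⟧ + ⟦ g (2ℤ * (N - 1ℤ + 1ℤ) + 1ℤ) ⟧)
      ≡⟨ sym (cong₂ _+_ (coeff-concatMap-range-∷ʳ (λ k → g (2ℤ * k)) 1ℤ N 1≤N+1 m n)
                        (coeff-concatMap-range-∷ʳ (λ k → g (2ℤ * k + 1ℤ)) 1ℤ (N - 1ℤ) 1≤N-1+1 m n)) ⟩
    ⟦ evens (N + 1ℤ) ⟧ + ⟦ concatMap (λ k → g (2ℤ * k + 1ℤ)) (range 1ℤ (N - 1ℤ + 1ℤ)) ⟧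
      ≡⟨ cong (λ z → ⟦ evens (N + 1ℤ) ⟧ + ⟦ concatMap (λ k → g (2ℤ * k + 1ℤ)) (range 1ℤ z) ⟧) (sym N+1-1) ⟩
    ⟦ evens (N + 1ℤ) ⟧ + ⟦ odds (N + 1ℤ) ⟧
      ≡⟨ sym (coeff-++ (evens (N + 1ℤ)) _ m n) ⟩
    ⟦ evens (N + 1ℤ) ++ odds (N + 1ℤ) ⟧ ∎
    where
    ⟦_⟧ : Poly → ℤ
    ⟦ P ⟧ = coeff P m n
    2≤2N+1 : 2ℤ ≤ 2ℤ * N + 1ℤ
    2≤2N+1 = ≤-by-difference (ℤ.+-mono-≤ (ℤ.+-mono-≤ 1≤N 1≤N) (+≤+ (ℕ.z≤n {1}))) (solve (N ∷ []))
    2≤2N+2 : 2ℤ ≤ 2ℤ * N + 1ℤ + 1ℤ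
    2≤2N+2 = ≤-by-difference (ℤ.+-mono-≤ (ℤ.+-mono-≤ 1≤N 1≤N) (+≤+ (ℕ.z≤n {2}))) (solve (N ∷ []))
    1≤N+1 : 1ℤ ≤ N + 1ℤ
    1≤N+1 = ℤ.≤-trans 1≤N (ℤ.<⇒≤ (i<i+1 N))
    1≤N-1+1 : 1ℤ ≤ N - 1ℤ + 1ℤ
    1≤N-1+1 = ≤-by-difference 1≤N (solve (N ∷ []))
    even-top : 2ℤ * N + 1ℤ + 1ℤ ≡ 2ℤ * (N + 1ℤ)
    even-top = solve (N ∷ [])
    odd-top : 2ℤ * N + 1ℤ ≡ 2ℤ * (N - 1ℤ + 1ℤ) + 1ℤ
    odd-top = solve (N ∷ [])
    N+1-1 : N + 1ℤ - 1ℤ ≡ N - 1ℤ + 1ℤ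
    N+1-1 = solve (N ∷ [])
    regroup : ∀ e o u v → e + o + u + v ≡ (e + v) + (o + u)
    regroup = solve-∀

  concatMap-evens-odds : ∀ n → concatMap g (range 2ℤ (2ℤ * + n)) ≈P evens (+ n) ++ odds (+ n)
  concatMap-evens-odds 0 m n = refl
  concatMap-evens-odds 1 m n = cong (λ P → coeff P m n) (sym (List.++-identityʳ (g 2ℤ ++ [])))
  concatMap-evens-odds (suc (suc k)) =
    subst (λ N → concatMap g (range 2ℤ (2ℤ * N)) ≈P evens N ++ odds N)
          (cong +_ (ℕ.+-comm (suc k) 1))
          (evens-odds-step {+ suc k} (+≤+ (ℕ.s≤s ℕ.z≤n)) (concatMap-evens-odds (suc k)))

-- The rows of H_comb

term : ℤ → ℤ → ℤ → ℤ → ℤ → Poly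
term a b c j i = guarded (does (2ℤ * i + 2ℤ * j ≤? a + b + 2ℤ * c - mpar c j))
                         (1ℤ , (a + 2ℤ * b + 3ℤ * c) - 2ℤ * i - j , i + eps b c i j)

row : ℤ → ℤ → ℤ → ℤ → Poly
row a b c j = concatMap (term a b c j) (range j (b + c))

ssumTerm : ℤ → ℤ → ℤ → ℤ → Poly
ssumTerm a b c ℓ = guarded (does (ℓ ≤? a - b)) (1ℤ , a + 2ℤ * c - ℓ , ℓ + b)

topMono : ℤ → ℤ → ℤ → ℤ → Mono
topMono a b c i = 1ℤ , a + 2ℤ * b + 2ℤ * c - 2ℤ * i , i

nextMono : ℤ → ℤ → ℤ → ℤ → Mono
nextMono a b c i = 1ℤ , a + 2ℤ * b + 2ℤ * c + 1ℤ - 2ℤ * i , i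

mpar-shift : ∀ c j → mpar (c - 2ℤ) j ≡ mpar c j
mpar-shift c j = trans (cong (λ z → + (∣ z ∣ % 2)) regroup) (cong (λ n → + n) (∣i-2∣%2≡∣i∣%2 (c - j)))
  where
  regroup : c - 2ℤ - j ≡ c - j - 2ℤ
  regroup = solve (c ∷ j ∷ [])

mpar-self : ∀ c → mpar c c ≡ 0ℤ
mpar-self c = cong (λ z → + (∣ z ∣ % 2)) (ℤ.+-inverseʳ c)

mpar-pred : ∀ c → mpar c (c - 1ℤ) ≡ 1ℤ
mpar-pred c = cong (λ z → + (∣ z ∣ % 2)) c-[c-1]≡1
  where
  c-[c-1]≡1 : c - (c - 1ℤ) ≡ 1ℤ
  c-[c-1]≡1 = solve (c ∷ [])

eps-below : ∀ b c i j → i + j ≤ b + c → eps b c i j ≡ 0ℤ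
eps-below b c i j i+j≤b+c = ℤ.i≥j⇒i⊔j≡i (≤-by-difference i+j≤b+c (solve (b ∷ c ∷ i ∷ j ∷ [])))

eps-above : ∀ b c i j → b + c ≤ i + j → eps b c i j ≡ i + j - b - c
eps-above b c i j b+c≤i+j = ℤ.i≤j⇒i⊔j≡j (≤-by-difference b+c≤i+j (solve (b ∷ c ∷ i ∷ j ∷ [])))

term-≡ : ∀ {a b c j i} μ p q {e x} → mpar c j ≡ μ →
  (a + b + 2ℤ * c - μ) - (2ℤ * i + 2ℤ * j) ≡ q - p →
  (a + 2ℤ * b + 3ℤ * c) - 2ℤ * i - j ≡ e → i + eps b c i j ≡ x →
  term a b c j i ≡ guarded (does (p ≤? q)) (1ℤ , e , x)
term-≡ {a} {b} {c} {j} {i} μ p q mpar≡μ bound e≡ x≡ =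
  cong₂ guarded (does-≤?-by-difference {2ℤ * i + 2ℤ * j} {a + b + 2ℤ * c - mpar c j} {p} {q} (sym bound′))
                (cong₂ (λ e x → 1ℤ , e , x) e≡ x≡)
  where
  bound′ : (a + b + 2ℤ * c - mpar c j) - (2ℤ * i + 2ℤ * j) ≡ q - p
  bound′ = trans (cong (λ ν → (a + b + 2ℤ * c - ν) - (2ℤ * i + 2ℤ * j)) mpar≡μ) bound

term-shift : ∀ a b c j i → term (a + 2ℤ) (b + 2ℤ) (c - 2ℤ) j i ≡ term a b c j i
term-shift a b c j i =
  cong₂ guarded (cong (λ M → does (2ℤ * i + 2ℤ * j ≤? M)) bound) (cong₂ (λ e x → 1ℤ , e , x) exponent degree)
  where
  sum : (a + 2ℤ) + (b + 2ℤ) + 2ℤ * (c - 2ℤ) ≡ a + b + 2ℤ * c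
  sum = solve (a ∷ b ∷ c ∷ [])
  bound : (a + 2ℤ) + (b + 2ℤ) + 2ℤ * (c - 2ℤ) - mpar (c - 2ℤ) j ≡ a + b + 2ℤ * c - mpar c j
  bound = cong₂ _-_ sum (mpar-shift c j)
  exponent : (a + 2ℤ) + 2ℤ * (b + 2ℤ) + 3ℤ * (c - 2ℤ) - 2ℤ * i - j ≡ a + 2ℤ * b + 3ℤ * c - 2ℤ * i - j
  exponent = solve (a ∷ b ∷ c ∷ i ∷ j ∷ [])
  excess : i + j - (b + 2ℤ) - (c - 2ℤ) ≡ i + j - b - c
  excess = solve (b ∷ c ∷ i ∷ j ∷ [])
  degree : i + eps (b + 2ℤ) (c - 2ℤ) i j ≡ i + eps b c i j
  degree = cong (λ z → i + (0ℤ ⊔ z)) excess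

row-shift : ∀ a b c j → row (a + 2ℤ) (b + 2ℤ) (c - 2ℤ) j ≡ row a b c j
row-shift a b c j = trans (List.concatMap-cong (term-shift a b c j) (range j ((b + 2ℤ) + (c - 2ℤ))))
                          (cong (λ h → concatMap (term a b c j) (range j h)) sum)
  where
  sum : (b + 2ℤ) + (c - 2ℤ) ≡ b + c
  sum = solve (b ∷ c ∷ [])

Hcomb-top-rows : ∀ a b c → 1ℤ ≤ c →
  Hcomb a b c ≡ Hcomb (a + 2ℤ) (b + 2ℤ) (c - 2ℤ) ++ row a b c (c - 1ℤ) ++ row a b c c
Hcomb-top-rows a b c 1≤c = begin
  concatMap (row a b c) (range 0ℤ c)
    ≡⟨ cong (concatMap (row a b c)) top-indices ⟩
  concatMap (row a b c) (range 0ℤ (c - 2ℤ) ++ (c - 1ℤ) ∷ c ∷ [])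
    ≡⟨ List.concatMap-++ (row a b c) (range 0ℤ (c - 2ℤ)) _ ⟩
  concatMap (row a b c) (range 0ℤ (c - 2ℤ)) ++ row a b c (c - 1ℤ) ++ row a b c c ++ []
    ≡⟨ cong₂ _++_ (sym (List.concatMap-cong (row-shift a b c) (range 0ℤ (c - 2ℤ))))
                  (cong (row a b c (c - 1ℤ) ++_) (List.++-identityʳ _)) ⟩
  Hcomb (a + 2ℤ) (b + 2ℤ) (c - 2ℤ) ++ row a b c (c - 1ℤ) ++ row a b c c ∎
  where
  0≤c-1 : 0ℤ ≤ c - 2ℤ + 1ℤ
  0≤c-1 = ≤-by-difference 1≤c (solve (c ∷ []))
  c-2≤c : c - 2ℤ ≤ c
  c-2≤c = ≤-by-difference (+≤+ (ℕ.z≤n {2})) (solve (c ∷ []))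
  c-2+1 : c - 2ℤ + 1ℤ ≡ c - 1ℤ
  c-2+1 = solve (c ∷ [])
  c-1+1 : c ≡ c - 1ℤ + 1ℤ
  c-1+1 = solve (c ∷ [])
  top-indices : range 0ℤ c ≡ range 0ℤ (c - 2ℤ) ++ (c - 1ℤ) ∷ c ∷ []
  top-indices = begin
    range 0ℤ c                                          ≡⟨ range-++ {mid = c - 2ℤ} 0≤c-1 c-2≤c ⟩
    range 0ℤ (c - 2ℤ) ++ range (c - 2ℤ + 1ℤ) c          ≡⟨ cong (range 0ℤ (c - 2ℤ) ++_) (cong₂ range c-2+1 c-1+1) ⟩
    range 0ℤ (c - 2ℤ) ++ range (c - 1ℤ) (c - 1ℤ + 1ℤ)    ≡⟨ cong (range 0ℤ (c - 2ℤ) ++_) (range-pair (c - 1ℤ)) ⟩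
    range 0ℤ (c - 2ℤ) ++ (c - 1ℤ) ∷ (c - 1ℤ + 1ℤ) ∷ []  ≡⟨ cong (λ z → range 0ℤ (c - 2ℤ) ++ (c - 1ℤ) ∷ z ∷ [])
                                                              (sym c-1+1) ⟩
    range 0ℤ (c - 2ℤ) ++ (c - 1ℤ) ∷ c ∷ []              ∎

row-split : ∀ a b c j mid → j ≤ mid + 1ℤ → mid ≤ b + c →
  row a b c j ≡ concatMap (term a b c j) (range j mid) ++ concatMap (term a b c j) (range (mid + 1ℤ) (b + c))
row-split a b c j mid j≤mid+1 mid≤b+c =
  trans (cong (concatMap (term a b c j)) (range-++ j≤mid+1 mid≤b+c))
        (List.concatMap-++ (term a b c j) (range j mid) _)

module _ (a b c : ℤ) where

  term-top-low : ∀ {i} → i ≤ b → term a b c c i ≡ guarded (does (2ℤ * i ≤? a + b)) (topMono a b c i)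
  term-top-low {i} i≤b =
    term-≡ {a} {b} {c} {c} {i} 0ℤ (2ℤ * i) (a + b) (mpar-self c) bound exponent degree
    where
    bound : (a + b + 2ℤ * c - 0ℤ) - (2ℤ * i + 2ℤ * c) ≡ (a + b) - 2ℤ * i
    bound = solve (a ∷ b ∷ c ∷ i ∷ [])
    exponent : (a + 2ℤ * b + 3ℤ * c) - 2ℤ * i - c ≡ a + 2ℤ * b + 2ℤ * c - 2ℤ * i
    exponent = solve (a ∷ b ∷ c ∷ i ∷ [])
    degree : i + eps b c i c ≡ i
    degree = trans (cong (λ z → i + z) (eps-below b c i c (ℤ.+-monoˡ-≤ c i≤b))) (ℤ.+-identityʳ i)

  term-top-high : ∀ {k} → 0ℤ ≤ k → term a b c c (k + b) ≡ ssumTerm a b c (2ℤ * k)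
  term-top-high {k} 0≤k =
    term-≡ {a} {b} {c} {c} {k + b} 0ℤ (2ℤ * k) (a - b) (mpar-self c) bound exponent degree
    where
    bound : (a + b + 2ℤ * c - 0ℤ) - (2ℤ * (k + b) + 2ℤ * c) ≡ (a - b) - 2ℤ * k
    bound = solve (a ∷ b ∷ c ∷ k ∷ [])
    exponent : (a + 2ℤ * b + 3ℤ * c) - 2ℤ * (k + b) - c ≡ a + 2ℤ * c - 2ℤ * k
    exponent = solve (a ∷ b ∷ c ∷ k ∷ [])
    excess : b + c ≤ (k + b) + c
    excess = ≤-by-difference 0≤k (solve (b ∷ c ∷ k ∷ []))
    degree : (k + b) + eps b c (k + b) c ≡ 2ℤ * k + b
    degree = trans (cong (λ z → (k + b) + z) (eps-above b c (k + b) c excess)) (solve (b ∷ c ∷ k ∷ []))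

  term-next-low : ∀ {i} → i ≤ b + 1ℤ →
    term a b c (c - 1ℤ) i ≡ guarded (does (2ℤ * i ≤? a + b + 1ℤ)) (nextMono a b c i)
  term-next-low {i} i≤b+1 =
    term-≡ {a} {b} {c} {c - 1ℤ} {i} 1ℤ (2ℤ * i) (a + b + 1ℤ) (mpar-pred c) bound exponent degree
    where
    bound : (a + b + 2ℤ * c - 1ℤ) - (2ℤ * i + 2ℤ * (c - 1ℤ)) ≡ (a + b + 1ℤ) - 2ℤ * i
    bound = solve (a ∷ b ∷ c ∷ i ∷ [])
    exponent : (a + 2ℤ * b + 3ℤ * c) - 2ℤ * i - (c - 1ℤ) ≡ a + 2ℤ * b + 2ℤ * c + 1ℤ - 2ℤ * i
    exponent = solve (a ∷ b ∷ c ∷ i ∷ [])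
    below : i + (c - 1ℤ) ≤ b + c
    below = ≤-by-difference i≤b+1 (solve (b ∷ c ∷ i ∷ []))
    degree : i + eps b c i (c - 1ℤ) ≡ i
    degree = trans (cong (λ z → i + z) (eps-below b c i (c - 1ℤ) below)) (ℤ.+-identityʳ i)

  term-next-high : ∀ {k} → 0ℤ ≤ k → term a b c (c - 1ℤ) (k + (b + 1ℤ)) ≡ ssumTerm a b c (2ℤ * k + 1ℤ)
  term-next-high {k} 0≤k =
    term-≡ {a} {b} {c} {c - 1ℤ} {k + (b + 1ℤ)} 1ℤ (2ℤ * k + 1ℤ) (a - b) (mpar-pred c) bound exponent degree
    where
    bound : (a + b + 2ℤ * c - 1ℤ) - (2ℤ * (k + (b + 1ℤ)) + 2ℤ * (c - 1ℤ)) ≡ (a - b) - (2ℤ * k + 1ℤ)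
    bound = solve (a ∷ b ∷ c ∷ k ∷ [])
    exponent : (a + 2ℤ * b + 3ℤ * c) - 2ℤ * (k + (b + 1ℤ)) - (c - 1ℤ) ≡ a + 2ℤ * c - (2ℤ * k + 1ℤ)
    exponent = solve (a ∷ b ∷ c ∷ k ∷ [])
    excess : b + c ≤ (k + (b + 1ℤ)) + (c - 1ℤ)
    excess = ≤-by-difference 0≤k (solve (b ∷ c ∷ k ∷ []))
    degree : (k + (b + 1ℤ)) + eps b c (k + (b + 1ℤ)) (c - 1ℤ) ≡ (2ℤ * k + 1ℤ) + b
    degree = trans (cong (λ z → (k + (b + 1ℤ)) + z) (eps-above b c (k + (b + 1ℤ)) (c - 1ℤ) excess))
                   (solve (b ∷ c ∷ k ∷ []))

row-top-high : ∀ a b c → concatMap (term a b c c) (range (b + 1ℤ) (b + c)) ≡ evens (ssumTerm a b c) c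
row-top-high a b c = begin
  concatMap t (range (b + 1ℤ) (b + c))   ≡⟨ cong₂ (λ l h → concatMap t (range l h)) (ℤ.+-comm b 1ℤ) (ℤ.+-comm b c) ⟩
  concatMap t (range (1ℤ + b) (c + b))   ≡⟨ cong (concatMap t) (range-shift 1ℤ c b) ⟩
  concatMap t (map (_+ b) (range 1ℤ c))  ≡⟨ List.concatMap-map t (_+ b) (range 1ℤ c) ⟩
  concatMap (λ k → t (k + b)) (range 1ℤ c)
    ≡⟨ concatMap-cong-range 1ℤ c (λ 1≤k _ → term-top-high a b c (ℤ.≤-trans (+≤+ ℕ.z≤n) 1≤k)) ⟩
  evens (ssumTerm a b c) c               ∎
  where
  t : ℤ → Poly
  t = term a b c c

row-next-high : ∀ a b c → concatMap (term a b c (c - 1ℤ)) (range (b + 1ℤ + 1ℤ) (b + c)) ≡ odds (ssumTerm a b c) c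
row-next-high a b c = begin
  concatMap t (range (b + 1ℤ + 1ℤ) (b + c))                  ≡⟨ cong₂ (λ l h → concatMap t (range l h))
                                                                       (ℤ.+-comm (b + 1ℤ) 1ℤ) top ⟩
  concatMap t (range (1ℤ + (b + 1ℤ)) ((c - 1ℤ) + (b + 1ℤ)))  ≡⟨ cong (concatMap t) (range-shift 1ℤ (c - 1ℤ) (b + 1ℤ)) ⟩
  concatMap t (map (_+ (b + 1ℤ)) (range 1ℤ (c - 1ℤ)))        ≡⟨ List.concatMap-map t (_+ (b + 1ℤ)) (range 1ℤ (c - 1ℤ)) ⟩
  concatMap (λ k → t (k + (b + 1ℤ))) (range 1ℤ (c - 1ℤ))
    ≡⟨ concatMap-cong-range 1ℤ (c - 1ℤ) (λ 1≤k _ → term-next-high a b c (ℤ.≤-trans (+≤+ ℕ.z≤n) 1≤k)) ⟩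
  odds (ssumTerm a b c) c                                    ∎
  where
  t : ℤ → Poly
  t = term a b c (c - 1ℤ)
  top : b + c ≡ (c - 1ℤ) + (b + 1ℤ)
  top = solve (b ∷ c ∷ [])

shift-H : ∀ a n s → shift s s (H a n) ≡ map (λ j → (1ℤ , a + 2ℤ * n + 3ℤ * s - 2ℤ * j , j)) (range s (n + s))
shift-H a n s = begin
  shift s s (H a n)                                              ≡⟨ sym (List.map-∘ (range 0ℤ n)) ⟩
  map (λ i → (1ℤ , a + 2ℤ * (n - i) + s , i + s)) (range 0ℤ n)  ≡⟨ List.map-cong (λ i → cong (λ e → (1ℤ , e , i + s))
                                                                                          (exponent i)) (range 0ℤ n) ⟩
  map (F ∘ (_+ s)) (range 0ℤ n)                                 ≡⟨ List.map-∘ (range 0ℤ n) ⟩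
  map F (map (_+ s) (range 0ℤ n))                               ≡⟨ cong (map F) (sym (range-shift 0ℤ n s)) ⟩
  map F (range (0ℤ + s) (n + s))                                ≡⟨ cong (λ z → map F (range z (n + s))) (ℤ.+-identityˡ s) ⟩
  map F (range s (n + s))                                       ∎
  where
  F : ℤ → Mono
  F j = 1ℤ , a + 2ℤ * n + 3ℤ * s - 2ℤ * j , j
  exponent : ∀ i → a + 2ℤ * (n - i) + s ≡ a + 2ℤ * n + 3ℤ * s - 2ℤ * (i + s)
  exponent i = solve (a ∷ n ∷ s ∷ i ∷ [])

H-empty : ∀ a n → n < 0ℤ → H a n ≡ []
H-empty a n n<0 = cong (map (λ i → (1ℤ , a + 2ℤ * (n - i) , i))) (range-empty n<0)

top-correction : ∀ {a b} → b ≤ a + 1ℤ → - δ a (b - 1ℤ) ≡ χ (does (b ≤? a)) - 1ℤ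
top-correction {a} {b} b≤a+1 with ≤+1-trichotomy {a} {b} b≤a+1
... | inj₁ refl =
  trans (cong -_ (χ-yes (b - 1ℤ ℤ.≟ b - 1ℤ) refl))
        (cong (_- 1ℤ) (sym (χ-no (b ≤? b - 1ℤ) (ℤ.<⇒≱ (i-1<i b)))))
... | inj₂ (inj₁ refl) =
  trans (cong -_ (χ-no (b ℤ.≟ b - 1ℤ) (ℤ.<⇒≢ (i-1<i b) ∘ sym)))
        (cong (_- 1ℤ) (sym (χ-yes (b ≤? b) ℤ.≤-refl)))
... | inj₂ (inj₂ b<a) =
  trans (cong -_ (χ-no (a ℤ.≟ b - 1ℤ) (ℤ.<⇒≢ (ℤ.<-trans (i-1<i b) b<a) ∘ sym)))
        (cong (_- 1ℤ) (sym (χ-yes (b ≤? a) (ℤ.<⇒≤ b<a))))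

next-correction : ∀ {a b} → b ≤ a + 1ℤ → - (δ a b + δ a (b - 1ℤ)) ≡ χ (does (b + 1ℤ ≤? a)) - 1ℤ
next-correction {a} {b} b≤a+1 with ≤+1-trichotomy {a} {b} b≤a+1
... | inj₁ refl =
  trans (cong -_ (cong₂ _+_ (χ-no (b - 1ℤ ℤ.≟ b) (ℤ.<⇒≢ (i-1<i b))) (χ-yes (b - 1ℤ ℤ.≟ b - 1ℤ) refl)))
        (cong (_- 1ℤ) (sym (χ-no (b + 1ℤ ≤? b - 1ℤ) (ℤ.<⇒≱ (ℤ.<-trans (i-1<i b) (i<i+1 b))))))
... | inj₂ (inj₁ refl) =
  trans (cong -_ (cong₂ _+_ (χ-yes (b ℤ.≟ b) refl) (χ-no (b ℤ.≟ b - 1ℤ) (ℤ.<⇒≢ (i-1<i b) ∘ sym))))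
        (cong (_- 1ℤ) (sym (χ-no (b + 1ℤ ≤? b) (ℤ.<⇒≱ (i<i+1 b)))))
... | inj₂ (inj₂ b<a) =
  trans (cong -_ (cong₂ _+_ (χ-no (a ℤ.≟ b) (ℤ.<⇒≢ b<a ∘ sym))
                            (χ-no (a ℤ.≟ b - 1ℤ) (ℤ.<⇒≢ (ℤ.<-trans (i-1<i b) b<a) ∘ sym))))
        (cong (_- 1ℤ) (sym (χ-yes (b + 1ℤ ≤? a) (≤-by-difference (<⇒1+≤ b<a) (solve (a ∷ b ∷ []))))))

row-top-low : ∀ a b c → c ≤ b + 1ℤ → b ≤ a + 1ℤ → c ≤ a + 1ℤ →
  concatMap (term a b c c) (range c b) ≈P shift c c (H (a + c) (b - c)) ++ (- δ a (b - 1ℤ) , a + 2ℤ * c , b) ∷ []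
row-top-low a b c c≤b+1 b≤a+1 c≤a+1 with c ≤? b
... | yes c≤b =
  subst (λ P → concatMap (term a b c c) (range c b) ≈P P ++ (- δ a (b - 1ℤ) , a + 2ℤ * c , b) ∷ [])
        (sym H-form)
        (concatMap-range-guarded-last c≤b below top top-mono (top-correction b≤a+1))
  where
  top-mono : topMono a b c b ≡ (1ℤ , a + 2ℤ * c , b)
  top-mono = cong (λ e → 1ℤ , e , b) (solve (a ∷ b ∷ c ∷ []))
  2i≤a+b : ∀ {i} → i < b → 2ℤ * i ≤ a + b
  2i≤a+b {i} i<b = ≤-by-difference
    (ℤ.+-mono-≤ (ℤ.+-mono-≤ (ℤ.+-mono-≤ (<⇒1+≤ i<b) (<⇒1+≤ i<b)) b≤a+1) (+≤+ (ℕ.z≤n {1})))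
    (solve (a ∷ b ∷ i ∷ []))
  below : ∀ {i} → c ≤ i → i < b → term a b c c i ≡ topMono a b c i ∷ []
  below {i} _ i<b = trans (term-top-low a b c (ℤ.<⇒≤ i<b))
    (cong (λ g → guarded g (topMono a b c i)) (dec-true (2ℤ * i ≤? a + b) (2i≤a+b i<b)))
  top : term a b c c b ≡ guarded (does (b ≤? a)) (1ℤ , a + 2ℤ * c , b)
  top = trans (term-top-low a b c ℤ.≤-refl)
              (cong₂ guarded (does-≤?-by-difference {2ℤ * b} {a + b} {b} {a} (solve (a ∷ b ∷ []))) top-mono)
  exponent : ∀ j → (a + c) + 2ℤ * (b - c) + 3ℤ * c - 2ℤ * j ≡ a + 2ℤ * b + 2ℤ * c - 2ℤ * j
  exponent j = solve (a ∷ b ∷ c ∷ j ∷ [])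
  b-c+c : b - c + c ≡ b
  b-c+c = solve (b ∷ c ∷ [])
  H-form : shift c c (H (a + c) (b - c)) ≡ map (topMono a b c) (range c b)
  H-form = trans (shift-H (a + c) (b - c) c)
                 (trans (List.map-cong (λ j → cong (λ e → 1ℤ , e , j) (exponent j)) (range c (b - c + c)))
                        (cong (map (topMono a b c)) (cong (range c) b-c+c)))
-- Here b = c - 1: both sums are empty, and a ≥ c - 1 = b makes δ a (b - 1) vanish.
... | no c≰b = λ m n → begin
  coeff (concatMap (term a b c c) (range c b)) m n
    ≡⟨ cong (λ xs → coeff (concatMap (term a b c c) xs) m n) (range-empty b<c) ⟩
  0ℤ
    ≡⟨ sym (zero-monomial (a + 2ℤ * c) b m n) ⟩
  coeff ((0ℤ , a + 2ℤ * c , b) ∷ []) m n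
    ≡⟨ cong (λ k → coeff ((- k , a + 2ℤ * c , b) ∷ []) m n) (sym δ≡0) ⟩
  coeff ((- δ a (b - 1ℤ) , a + 2ℤ * c , b) ∷ []) m n
    ≡⟨ cong (λ P → coeff (shift c c P ++ (- δ a (b - 1ℤ) , a + 2ℤ * c , b) ∷ []) m n)
            (sym (H-empty (a + c) (b - c) b-c<0)) ⟩
  coeff (shift c c (H (a + c) (b - c)) ++ (- δ a (b - 1ℤ) , a + 2ℤ * c , b) ∷ []) m n ∎
  where
  b<c : b < c
  b<c = ℤ.≰⇒> c≰b
  b-c<0 : b - c < 0ℤ
  b-c<0 = +1≤⇒< (≤-by-difference (<⇒1+≤ b<c) (solve (b ∷ c ∷ [])))
  b-1<a : b - 1ℤ < a
  b-1<a = +1≤⇒< (≤-by-difference (ℤ.+-mono-≤ (<⇒1+≤ b<c) c≤a+1) (solve (a ∷ b ∷ c ∷ [])))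
  δ≡0 : δ a (b - 1ℤ) ≡ 0ℤ
  δ≡0 = χ-no (a ℤ.≟ b - 1ℤ) (ℤ.<⇒≢ b-1<a ∘ sym)

row-next-low : ∀ a b c → c ≤ b + 1ℤ → b ≤ a + 1ℤ →
  concatMap (term a b c (c - 1ℤ)) (range (c - 1ℤ) (b + 1ℤ)) ≈P
  shift (c - 1ℤ) (c - 1ℤ) (H (a + c) (b - c + 2ℤ)) ++ (- (δ a b + δ a (b - 1ℤ)) , a + 2ℤ * c - 1ℤ , b + 1ℤ) ∷ []
row-next-low a b c c≤b+1 b≤a+1 =
  subst (λ P → concatMap (term a b c (c - 1ℤ)) (range (c - 1ℤ) (b + 1ℤ)) ≈P
               P ++ (- (δ a b + δ a (b - 1ℤ)) , a + 2ℤ * c - 1ℤ , b + 1ℤ) ∷ [])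
        (sym H-form)
        (concatMap-range-guarded-last c-1≤b+1 below top top-mono (next-correction b≤a+1))
  where
  c-1≤b+1 : c - 1ℤ ≤ b + 1ℤ
  c-1≤b+1 = ≤-by-difference (ℤ.+-mono-≤ c≤b+1 (+≤+ (ℕ.z≤n {1}))) (solve (b ∷ c ∷ []))
  top-mono : nextMono a b c (b + 1ℤ) ≡ (1ℤ , a + 2ℤ * c - 1ℤ , b + 1ℤ)
  top-mono = cong (λ e → 1ℤ , e , b + 1ℤ) (solve (a ∷ b ∷ c ∷ []))
  2i≤a+b+1 : ∀ {i} → i < b + 1ℤ → 2ℤ * i ≤ a + b + 1ℤ
  2i≤a+b+1 {i} i<b+1 = ≤-by-difference
    (ℤ.+-mono-≤ (ℤ.+-mono-≤ (<⇒1+≤ i<b+1) (<⇒1+≤ i<b+1)) b≤a+1)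
    (solve (a ∷ b ∷ i ∷ []))
  below : ∀ {i} → c - 1ℤ ≤ i → i < b + 1ℤ → term a b c (c - 1ℤ) i ≡ nextMono a b c i ∷ []
  below {i} _ i<b+1 = trans (term-next-low a b c (ℤ.<⇒≤ i<b+1))
    (cong (λ g → guarded g (nextMono a b c i)) (dec-true (2ℤ * i ≤? a + b + 1ℤ) (2i≤a+b+1 i<b+1)))
  top : term a b c (c - 1ℤ) (b + 1ℤ) ≡ guarded (does (b + 1ℤ ≤? a)) (1ℤ , a + 2ℤ * c - 1ℤ , b + 1ℤ)
  top = trans (term-next-low a b c ℤ.≤-refl)
              (cong₂ guarded (does-≤?-by-difference {2ℤ * (b + 1ℤ)} {a + b + 1ℤ} {b + 1ℤ} {a}
                                                    (solve (a ∷ b ∷ [])))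
                             top-mono)
  exponent : ∀ j → (a + c) + 2ℤ * (b - c + 2ℤ) + 3ℤ * (c - 1ℤ) - 2ℤ * j ≡ a + 2ℤ * b + 2ℤ * c + 1ℤ - 2ℤ * j
  exponent j = solve (a ∷ b ∷ c ∷ j ∷ [])
  top-index : b - c + 2ℤ + (c - 1ℤ) ≡ b + 1ℤ
  top-index = solve (b ∷ c ∷ [])
  H-form : shift (c - 1ℤ) (c - 1ℤ) (H (a + c) (b - c + 2ℤ)) ≡ map (nextMono a b c) (range (c - 1ℤ) (b + 1ℤ))
  H-form = trans (shift-H (a + c) (b - c + 2ℤ) (c - 1ℤ))
                 (trans (List.map-cong (λ j → cong (λ e → 1ℤ , e , j) (exponent j))
                                       (range (c - 1ℤ) (b - c + 2ℤ + (c - 1ℤ))))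
                        (cong (map (nextMono a b c)) (cong (range (c - 1ℤ)) top-index)))

row-top : ∀ a b c → 1ℤ ≤ c → c ≤ b + 1ℤ → b ≤ a + 1ℤ → c ≤ a + 1ℤ →
  row a b c c ≈P (shift c c (H (a + c) (b - c)) ++ (- δ a (b - 1ℤ) , a + 2ℤ * c , b) ∷ []) ++ evens (ssumTerm a b c) c
row-top a b c 1≤c c≤b+1 b≤a+1 c≤a+1 =
  subst (_≈P (H₁ ++ X₀ ∷ []) ++ evens (ssumTerm a b c) c) (sym (row-split a b c c b c≤b+1 b≤b+c))
        (++-cong {low} {H₁ ++ X₀ ∷ []} (row-top-low a b c c≤b+1 b≤a+1 c≤a+1) (≡⇒≈P (row-top-high a b c)))
  where
  low H₁ : Poly
  low = concatMap (term a b c c) (range c b)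
  H₁ = shift c c (H (a + c) (b - c))
  X₀ : Mono
  X₀ = (- δ a (b - 1ℤ) , a + 2ℤ * c , b)
  b≤b+c : b ≤ b + c
  b≤b+c = ≤-by-difference (ℤ.≤-trans (+≤+ ℕ.z≤n) 1≤c) (solve (b ∷ c ∷ []))

row-next : ∀ a b c → 1ℤ ≤ c → c ≤ b + 1ℤ → b ≤ a + 1ℤ →
  row a b c (c - 1ℤ) ≈P
  (shift (c - 1ℤ) (c - 1ℤ) (H (a + c) (b - c + 2ℤ)) ++ (- (δ a b + δ a (b - 1ℤ)) , a + 2ℤ * c - 1ℤ , b + 1ℤ) ∷ [])
    ++ odds (ssumTerm a b c) c
row-next a b c 1≤c c≤b+1 b≤a+1 =
  subst (_≈P (H₂ ++ X₁ ∷ []) ++ odds (ssumTerm a b c) c)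
        (sym (row-split a b c (c - 1ℤ) (b + 1ℤ) c-1≤b+2 b+1≤b+c))
        (++-cong {low} {H₂ ++ X₁ ∷ []} (row-next-low a b c c≤b+1 b≤a+1) (≡⇒≈P (row-next-high a b c)))
  where
  low H₂ : Poly
  low = concatMap (term a b c (c - 1ℤ)) (range (c - 1ℤ) (b + 1ℤ))
  H₂ = shift (c - 1ℤ) (c - 1ℤ) (H (a + c) (b - c + 2ℤ))
  X₁ : Mono
  X₁ = (- (δ a b + δ a (b - 1ℤ)) , a + 2ℤ * c - 1ℤ , b + 1ℤ)
  c-1≤b+2 : c - 1ℤ ≤ b + 1ℤ + 1ℤ
  c-1≤b+2 = ≤-by-difference (ℤ.+-mono-≤ c≤b+1 (+≤+ (ℕ.z≤n {2}))) (solve (b ∷ c ∷ []))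
  b+1≤b+c : b + 1ℤ ≤ b + c
  b+1≤b+c = ≤-by-difference 1≤c (solve (b ∷ c ∷ []))

Ssum-split : ∀ a b c → 0ℤ ≤ c → Ssum a b c ≈P evens (ssumTerm a b c) c ++ odds (ssumTerm a b c) c
Ssum-split a b (+ n) _ =
  subst (_≈P evens (ssumTerm a b c) c ++ odds (ssumTerm a b c) c) (sym as-guarded-sum)
        (concatMap-evens-odds (ssumTerm a b c) n)
  where
  c : ℤ
  c = + n
  s : ℤ → Mono
  s ℓ = 1ℤ , a + 2ℤ * c - ℓ , ℓ + b
  as-guarded-sum : Ssum a b c ≡ concatMap (ssumTerm a b c) (range 2ℤ (2ℤ * c))
  as-guarded-sum = begin
    map s (range 2ℤ (2ℤ * c ⊓ (a - b)))                ≡⟨ cong (map s) (sym (filter-≤-range 2ℤ (2ℤ * c) (a - b))) ⟩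
    map s (filter (_≤? a - b) (range 2ℤ (2ℤ * c)))     ≡⟨ sym (concatMap-guarded (_≤? a - b) s (range 2ℤ (2ℤ * c))) ⟩
    concatMap (ssumTerm a b c) (range 2ℤ (2ℤ * c))     ∎

regroup-rows : ∀ P R₁ R₀ H₁ H₂ X₀ X₁ E O S →
  R₁ ≈P (H₂ ++ X₁ ∷ []) ++ O → R₀ ≈P (H₁ ++ X₀ ∷ []) ++ E → S ≈P E ++ O →
  P ++ R₁ ++ R₀ ≈P P ++ H₁ ++ H₂ ++ S ++ X₀ ∷ X₁ ∷ []
regroup-rows P R₁ R₀ H₁ H₂ X₀ X₁ E O S R₁≈ R₀≈ S≈ m n = begin
  ⟦ P ++ R₁ ++ R₀ ⟧
    ≡⟨ ⟦++⟧₃ P R₁ R₀ ⟩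
  ⟦ P ⟧ + (⟦ R₁ ⟧ + ⟦ R₀ ⟧)
    ≡⟨ cong₂ (λ r₁ r₀ → ⟦ P ⟧ + (r₁ + r₀)) (trans (R₁≈ m n) (⟦++⟧₃′ H₂ (X₁ ∷ []) O))
                                           (trans (R₀≈ m n) (⟦++⟧₃′ H₁ (X₀ ∷ []) E)) ⟩
  ⟦ P ⟧ + ((⟦ H₂ ⟧ + ⟦ X₁ ∷ [] ⟧ + ⟦ O ⟧) + (⟦ H₁ ⟧ + ⟦ X₀ ∷ [] ⟧ + ⟦ E ⟧))
    ≡⟨ rearrange ⟦ P ⟧ ⟦ H₁ ⟧ ⟦ H₂ ⟧ ⟦ E ⟧ ⟦ O ⟧ ⟦ X₀ ∷ [] ⟧ ⟦ X₁ ∷ [] ⟧ ⟩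
  ⟦ P ⟧ + (⟦ H₁ ⟧ + (⟦ H₂ ⟧ + ((⟦ E ⟧ + ⟦ O ⟧) + (⟦ X₀ ∷ [] ⟧ + ⟦ X₁ ∷ [] ⟧))))
    ≡⟨ cong₂ (λ s x → ⟦ P ⟧ + (⟦ H₁ ⟧ + (⟦ H₂ ⟧ + (s + x))))
             (sym (trans (S≈ m n) (coeff-++ E O m n))) (sym (coeff-++ (X₀ ∷ []) (X₁ ∷ []) m n)) ⟩
  ⟦ P ⟧ + (⟦ H₁ ⟧ + (⟦ H₂ ⟧ + (⟦ S ⟧ + ⟦ X₀ ∷ X₁ ∷ [] ⟧)))
    ≡⟨ sym (cong (λ z → ⟦ P ⟧ + z) (trans (coeff-++ H₁ _ m n) (cong (λ z → ⟦ H₁ ⟧ + z) (⟦++⟧₃ H₂ S _)))) ⟩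
  ⟦ P ⟧ + ⟦ H₁ ++ H₂ ++ S ++ X₀ ∷ X₁ ∷ [] ⟧
    ≡⟨ sym (coeff-++ P _ m n) ⟩
  ⟦ P ++ H₁ ++ H₂ ++ S ++ X₀ ∷ X₁ ∷ [] ⟧ ∎
  where
  ⟦_⟧ : Poly → ℤ
  ⟦ Q ⟧ = coeff Q m n
  ⟦++⟧₃ : ∀ A B C → ⟦ A ++ B ++ C ⟧ ≡ ⟦ A ⟧ + (⟦ B ⟧ + ⟦ C ⟧)
  ⟦++⟧₃ A B C = trans (coeff-++ A (B ++ C) m n) (cong (λ z → ⟦ A ⟧ + z) (coeff-++ B C m n))
  ⟦++⟧₃′ : ∀ A B C → ⟦ (A ++ B) ++ C ⟧ ≡ ⟦ A ⟧ + ⟦ B ⟧ + ⟦ C ⟧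
  ⟦++⟧₃′ A B C = trans (coeff-++ (A ++ B) C m n) (cong (_+ ⟦ C ⟧) (coeff-++ A B m n))
  rearrange : ∀ p h₁ h₂ e o x₀ x₁ →
    p + ((h₂ + x₁ + o) + (h₁ + x₀ + e)) ≡ p + (h₁ + (h₂ + ((e + o) + (x₀ + x₁))))
  rearrange = solve-∀

lemma4p11 : (a b c : ℤ) → b ≤ a + 1ℤ → c ≤ a + 1ℤ → c ≤ b + 1ℤ → 1ℤ ≤ c →
    Hcomb a b c ≈P RHS a b c
lemma4p11 a b c b≤a+1 c≤a+1 c≤b+1 1≤c =
  subst (_≈P RHS a b c) (sym (Hcomb-top-rows a b c 1≤c))
        (regroup-rows P (row a b c (c - 1ℤ)) (row a b c c) H₁ H₂ X₀ X₁ E O (Ssum a b c)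
                      (row-next a b c 1≤c c≤b+1 b≤a+1)
                      (row-top a b c 1≤c c≤b+1 b≤a+1 c≤a+1)
                      (Ssum-split a b c (ℤ.≤-trans (+≤+ ℕ.z≤n) 1≤c)))
  where
  P H₁ H₂ E O : Poly
  P = Hcomb (a + 2ℤ) (b + 2ℤ) (c - 2ℤ)
  H₁ = shift c c (H (a + c) (b - c))
  H₂ = shift (c - 1ℤ) (c - 1ℤ) (H (a + c) (b - c + 2ℤ))
  E = evens (ssumTerm a b c) c
  O = odds (ssumTerm a b c) c
  X₀ X₁ : Mono
  X₀ = (- δ a (b - 1ℤ) , a + 2ℤ * c , b)
  X₁ = (- (δ a b + δ a (b - 1ℤ)) , a + 2ℤ * c - 1ℤ , b + 1ℤ)
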